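{- Let $p$ be an odd prime and $r$ an odd natural number. Then $C_{S(p^r)^*}\leq 3$.
   Context: For a natural number $m$, $\mathbb Z_m=\mathbb Z/m\mathbb Z$ and $S(m)^*=\{x^2:x\in\mathbb Z_m\}\setminus\{0\}$. For $A\subseteq\mathbb Z_m$, a subsequence $T$ of a sequence $(x_1,\dots,x_k)$ in $\mathbb Z_m$, with nonempty index set $I$, is an $A$-weighted zero-sum subsequence if there exist $a_i\in A$ ($i\in I$) with $\sum_{i\in I}a_ix_i=0$. $C_{S(m)^*}$ is the least positive integer $k$ such that every sequence of length $k$ in $\mathbb Z_m$ has an $S(m)^*$-weighted zero-sum subsequence consisting of consecutive terms. -}

module Defs where

open import Data.Nat using (ℕ; zero; suc; _+_; _*_; _≤_; _<_)
open import Data.Nat.Divisibility using (_∣_)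
open import Data.Product using (Σ; ∃; _×_; _,_)
open import Relation.Nullary using (¬_)
open import Relation.Binary.PropositionalEquality using (_≡_)

-- Elements of ℤ_m are represented by natural numbers a with a < m;
-- congruence mod m is  m ∣ (a - b), expressed without subtraction.
infix 4 _≡[_]_
_≡[_]_ : ℕ → ℕ → ℕ → Set
a ≡[ m ] b = Σ ℕ λ k → Σ ℕ λ l → (a + k * m ≡ b + l * m)

InSStar : ℕ → ℕ → Set
InSStar m a = (a < m) × (¬ (m ∣ a)) × (Σ ℕ λ x → (x < m) × (x * x ≡[ m ] a))

blockSum : (ℕ → ℕ) → ℕ → ℕ → ℕ
blockSum f i zero = f i
blockSum f i (suc len) = f i + blockSum f (suc i) len

HasConsecZS : (m k : ℕ) → (ℕ → ℕ) → Set
HasConsecZS m k x =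
  Σ ℕ λ i → Σ ℕ λ len → (i + len < k) ×
    (Σ (ℕ → ℕ) λ w → ((t : ℕ) → i ≤ t → t ≤ i + len → InSStar m (w t)) ×
       (m ∣ blockSum (λ t → w t * x t) i len))

-- Every sequence of length k in ℤ_m has such a subsequence.
-- (Sequences are indexed by ℕ; only the entries at indices < k matter.)
AllSeqsHave : (m k : ℕ) → Set
AllSeqsHave m k = (x : ℕ → ℕ) → ((t : ℕ) → t < k → x t < m) → HasConsecZS m k x

IsCSStar : (m c : ℕ) → Set
IsCSStar m c = (1 ≤ c) × AllSeqsHave m c × ((k : ℕ) → 1 ≤ k → AllSeqsHave m k → c ≤ k)

-- Let m = p^(2s+1) and W = p^(2s) = (p^s)², a nonzero square mod m with W · p ≡ 0 (mod m).
-- Hence if p ∣ Σ cₜ² xₜ with p ∤ cₜ, the weights W cₜ² ∈ S(m)^* give a zero sum mod m.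
-- Upper bound: a term divisible by p is a block on its own. Otherwise the (p+1)/2 residues a² x₀
-- and the (p+1)/2 residues −x₁ − b² x₂ (0 ≤ a, b ≤ (p−1)/2) are pairwise distinct, so the two
-- families meet: a² x₀ + x₁ + b² x₂ ≡ 0 (mod p).
-- Lower bound: choose n with −n a non-residue mod p and take the sequence (1, n). A weighted
-- zero sum reads y² + n z² ≡ 0 (mod p^(2s+1)); then p ∣ z, so p ∣ y, and dividing by p² descends
-- to p^(2s+1) ∣ z², i.e. a zero weight.

module Submission where

open import Defs
open import Data.Nat using (ℕ; zero; suc; _+_; _*_; _∸_; _^_; _≤_; _<_; _≤?_; z≤n; s≤s; s≤s⁻¹; NonZero; >-nonZero⁻¹; nonTrivial⇒n>1)
open import Data.Nat.Properties
open import Data.Nat.DivMod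
open import Data.Nat.Divisibility
open import Data.Nat.Primality using (Prime; euclidsLemma; prime⇒nonZero; prime⇒irreducible; prime⇒nonTrivial; ¬prime[1])
open import Data.Nat.Coprimality using (Coprime; coprime-Bézout)
open import Data.Nat.GCD using (module Bézout)
open import Data.Nat.Tactic.RingSolver using (solve-∀)
open import Data.Fin using (Fin; toℕ; fromℕ<; splitAt; join)
import Data.Fin.Properties as Fin
open import Data.Product using (Σ; ∃; ∃₂; _×_; _,_; proj₁; proj₂)
open import Data.Sum using (inj₁; inj₂; [_,_]′)
open import Data.Empty using (⊥-elim)
open import Function using (_∘_; id)
open import Function.Definitions using (Injective)
open import Relation.Nullary using (¬_; yes; no; ¬?; contradiction)
open import Relation.Nullary.Decidable using (decidable-stable)
open import Relation.Binary.Bundles using (Setoid)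
open import Relation.Binary.Structures using (IsEquivalence)
open import Relation.Binary.PropositionalEquality
import Relation.Binary.Reasoning.Setoid

blockSum-*ˡ : ∀ k f i len → blockSum (λ t → k * f t) i len ≡ k * blockSum f i len
blockSum-*ˡ k f i zero      = refl
blockSum-*ˡ k f i (suc len) = begin
  k * f i + blockSum (λ t → k * f t) (suc i) len ≡⟨ cong (k * f i +_) (blockSum-*ˡ k f (suc i) len) ⟩
  k * f i + k * blockSum f (suc i) len          ≡⟨ *-distribˡ-+ k (f i) _ ⟨
  k * (f i + blockSum f (suc i) len)            ∎
  where open ≡-Reasoning

allSeqsHave-mono : ∀ {m k k′} → k ≤ k′ → AllSeqsHave m k → AllSeqsHave m k′
allSeqsHave-mono k≤k′ all x x<m with all x (λ t t<k → x<m t (<-≤-trans t<k k≤k′))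
... | i , len , i+len<k , rest = i , len , <-≤-trans i+len<k k≤k′ , rest

module Congruence (d : ℕ) .{{_ : NonZero d}} where

  infix 4 _≈_
  -- A record rather than a % d ≡ b % d itself, so that a and b can be inferred from a proof.
  record _≈_ (a b : ℕ) : Set where
    constructor mk≈
    field residue : a % d ≡ b % d

  ≈-reflexive : ∀ {a b} → a ≡ b → a ≈ b
  ≈-reflexive refl = mk≈ refl

  ≈-isEquivalence : IsEquivalence _≈_
  ≈-isEquivalence = record
    { refl  = mk≈ refl
    ; sym   = λ (mk≈ e) → mk≈ (sym e)
    ; trans = λ (mk≈ e) (mk≈ f) → mk≈ (trans e f)
    }

  ≈-setoid : Setoid _ _
  ≈-setoid = record { isEquivalence = ≈-isEquivalence }

  open IsEquivalence ≈-isEquivalence public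
    using () renaming (refl to ≈-refl; sym to ≈-sym; trans to ≈-trans)

  module ≈-Reasoning = Relation.Binary.Reasoning.Setoid ≈-setoid

  %-≈ : ∀ a → a % d ≈ a
  %-≈ a = mk≈ (m%n%n≡m%n a d)

  +-cong : ∀ {a b c e} → a ≈ b → c ≈ e → a + c ≈ b + e
  +-cong {a} {b} {c} {e} (mk≈ h) (mk≈ k) = mk≈ (begin
    (a + c) % d           ≡⟨ %-distribˡ-+ a c d ⟩
    (a % d + c % d) % d   ≡⟨ cong₂ (λ x y → (x + y) % d) h k ⟩
    (b % d + e % d) % d   ≡⟨ %-distribˡ-+ b e d ⟨
    (b + e) % d           ∎)
    where open ≡-Reasoning

  *-cong : ∀ {a b c e} → a ≈ b → c ≈ e → a * c ≈ b * e
  *-cong {a} {b} {c} {e} (mk≈ h) (mk≈ k) = mk≈ (begin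
    (a * c) % d           ≡⟨ %-distribˡ-* a c d ⟩
    (a % d * (c % d)) % d ≡⟨ cong₂ (λ x y → (x * y) % d) h k ⟩
    (b % d * (e % d)) % d ≡⟨ %-distribˡ-* b e d ⟨
    (b * e) % d           ∎)
    where open ≡-Reasoning

  +-congˡ : ∀ c {a b} → a ≈ b → c + a ≈ c + b
  +-congˡ c = +-cong (≈-refl {c})

  +-congʳ : ∀ c {a b} → a ≈ b → a + c ≈ b + c
  +-congʳ c h = +-cong h (≈-refl {c})

  *-congˡ : ∀ c {a b} → a ≈ b → c * a ≈ c * b
  *-congˡ c = *-cong (≈-refl {c})

  *-congʳ : ∀ c {a b} → a ≈ b → a * c ≈ b * c
  *-congʳ c h = *-cong h (≈-refl {c})

  0%d≡0 : 0 % d ≡ 0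
  0%d≡0 = m<n⇒m%n≡m (>-nonZero⁻¹ d)

  ∣⇒≈0 : ∀ {a} → d ∣ a → a ≈ 0
  ∣⇒≈0 {a} d∣a = mk≈ (trans (n∣m⇒m%n≡0 a d d∣a) (sym 0%d≡0))

  ≈0⇒∣ : ∀ {a} → a ≈ 0 → d ∣ a
  ≈0⇒∣ {a} (mk≈ h) = m%n≡0⇒n∣m a d (trans h 0%d≡0)

  ≈⇒≡ : ∀ {a b} → a < d → b < d → a ≈ b → a ≡ b
  ≈⇒≡ a<d b<d (mk≈ h) = trans (sym (m<n⇒m%n≡m a<d)) (trans h (m<n⇒m%n≡m b<d))

  neg : ℕ → ℕ
  neg a = d ∸ a % d

  neg-+ : ∀ a → neg a + a ≈ 0
  neg-+ a = begin
    neg a + a       ≈⟨ +-congˡ (neg a) (%-≈ a) ⟨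
    neg a + a % d   ≡⟨ m∸n+n≡m (m%n≤n a d) ⟩
    d               ≈⟨ ∣⇒≈0 ∣-refl ⟩
    0               ∎
    where open ≈-Reasoning

  +-cancelˡ : ∀ {a b c} → a + b ≈ a + c → b ≈ c
  +-cancelˡ {a} {b} {c} h = begin
    b                 ≈⟨ +-congʳ b (neg-+ a) ⟨
    neg a + a + b     ≡⟨ +-assoc (neg a) a b ⟩
    neg a + (a + b)   ≈⟨ +-congˡ (neg a) h ⟩
    neg a + (a + c)   ≡⟨ +-assoc (neg a) a c ⟨
    neg a + a + c     ≈⟨ +-congʳ c (neg-+ a) ⟩
    c                 ∎
    where open ≈-Reasoning

  neg-injective : ∀ {a b} → neg a ≈ neg b → a ≈ b
  neg-injective {a} {b} h =
    +-cancelˡ (≈-trans (neg-+ a) (≈-sym (≈-trans (+-congʳ b h) (neg-+ b))))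

  +≈0⇒square≈ : ∀ {a b} → a + b ≈ 0 → a * a ≈ b * b
  +≈0⇒square≈ {a} {b} h = +-cancelˡ (begin
    a * b + a * a   ≡⟨ *-distribˡ-+ a b a ⟨
    a * (b + a)     ≡⟨ cong (a *_) (+-comm b a) ⟩
    a * (a + b)     ≈⟨ *-congˡ a h ⟩
    a * 0           ≡⟨ trans (*-zeroʳ a) (sym (*-zeroʳ b)) ⟩
    b * 0           ≈⟨ *-congˡ b h ⟨
    b * (a + b)     ≡⟨ *-distribˡ-+ b a b ⟩
    b * a + b * b   ≡⟨ cong (_+ b * b) (*-comm b a) ⟩
    a * b + b * b   ∎)
    where open ≈-Reasoning

  mod-≡⇒≈ : ∀ {a b} → a mod d ≡ b mod d → a ≈ b
  mod-≡⇒≈ e = mk≈ (trans (sym (Fin.toℕ-fromℕ< _)) (trans (cong toℕ e) (Fin.toℕ-fromℕ< _)))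

  ≡[]⇒≈ : ∀ {a b} → a ≡[ d ] b → a ≈ b
  ≡[]⇒≈ {a} {b} (k , l , e) = mk≈ (begin
    a % d             ≡⟨ [m+kn]%n≡m%n a k d ⟨
    (a + k * d) % d   ≡⟨ cong (_% d) e ⟩
    (b + l * d) % d   ≡⟨ [m+kn]%n≡m%n b l d ⟩
    b % d             ∎)
    where open ≡-Reasoning

  ≈⇒≡[] : ∀ {a b} → a ≈ b → a ≡[ d ] b
  ≈⇒≡[] {a} {b} (mk≈ h) = b / d , a / d , (begin
    a + b / d * d                 ≡⟨ cong (_+ b / d * d) (m≡m%n+[m/n]*n a d) ⟩
    a % d + a / d * d + b / d * d ≡⟨ cong (λ r → r + a / d * d + b / d * d) h ⟩
    b % d + a / d * d + b / d * d ≡⟨ swap (b % d) (a / d * d) (b / d * d) ⟩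
    b % d + b / d * d + a / d * d ≡⟨ cong (_+ a / d * d) (m≡m%n+[m/n]*n b d) ⟨
    b + a / d * d                 ∎)
    where
    open ≡-Reasoning
    swap : ∀ x y z → x + y + z ≡ x + z + y
    swap = solve-∀

  blockSum-cong : ∀ {f g} → (∀ t → f t ≈ g t) → ∀ i len → blockSum f i len ≈ blockSum g i len
  blockSum-cong f≈g i zero      = f≈g i
  blockSum-cong f≈g i (suc len) = +-cong (f≈g i) (blockSum-cong f≈g (suc i) len)

injections-meet : ∀ {k l n} {A : Fin k → Fin n} {B : Fin l → Fin n} →
  Injective _≡_ _≡_ A → Injective _≡_ _≡_ B → n < k + l → ∃₂ λ a b → A a ≡ B b
injections-meet {k} {l} {n} {A} {B} A-inj B-inj n<k+l
  with Fin.any? (λ a → Fin.any? (λ b → A a Fin.≟ B b))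
... | yes (a , b , A≡B) = a , b , A≡B
... | no disjoint = contradiction (Fin.injective⇒≤ A⊎B∘splitAt-inj) (<⇒≱ n<k+l)
  where
  A⊎B-inj : Injective _≡_ _≡_ [ A , B ]′
  A⊎B-inj {inj₁ a} {inj₁ a′} e = cong inj₁ (A-inj e)
  A⊎B-inj {inj₁ a} {inj₂ b}  e = ⊥-elim (disjoint (a , b , e))
  A⊎B-inj {inj₂ b} {inj₁ a}  e = ⊥-elim (disjoint (a , b , sym e))
  A⊎B-inj {inj₂ b} {inj₂ b′} e = cong inj₂ (B-inj e)

  A⊎B∘splitAt-inj : Injective _≡_ _≡_ ([ A , B ]′ ∘ splitAt k)
  A⊎B∘splitAt-inj {i} {j} e = begin
    i                     ≡⟨ Fin.join-splitAt k l i ⟨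
    join k l (splitAt k i) ≡⟨ cong (join k l) (A⊎B-inj {splitAt k i} {splitAt k j} e) ⟩
    join k l (splitAt k j) ≡⟨ Fin.join-splitAt k l j ⟩
    j                     ∎
    where open ≡-Reasoning

module OddPrime (p q : ℕ) (p-prime : Prime p) (p≡2q+1 : p ≡ 2 * q + 1) where

  instance
    p-nonZero : NonZero p
    p-nonZero = prime⇒nonZero p-prime
    p²-nonZero : NonZero (p * p)
    p²-nonZero = m*n≢0 p p

  open Congruence p

  p≡1+q+q : p ≡ suc (q + q)
  p≡1+q+q = trans p≡2q+1 (shape q)
    where
    shape : ∀ q → 2 * q + 1 ≡ suc (q + q)
    shape = solve-∀

  q+q<p : q + q < p
  q+q<p = ≤-reflexive (sym p≡1+q+q)

  q<p : q < p
  q<p = ≤-<-trans (m≤m+n q q) q+q<p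

  0<q : 0 < q
  0<q = n≢0⇒n>0 λ q≡0 → ¬prime[1] (subst Prime (trans p≡1+q+q (cong (λ k → suc (k + k)) q≡0)) p-prime)

  1+q<p : suc q < p
  1+q<p = ≤-trans (s≤s (subst (_≤ q + q) (+-comm q 1) (+-monoʳ-≤ q 0<q))) (≤-reflexive (sym p≡1+q+q))

  ∣⇒≡0 : ∀ {c} → p ∣ c → c < p → c ≡ 0
  ∣⇒≡0 {zero}  _   _   = refl
  ∣⇒≡0 {suc c} p∣c c<p = contradiction (∣⇒≤ p∣c) (<⇒≱ c<p)

  ∤-nonzero≤q : ∀ {a} → a ≢ 0 → a ≤ q → ¬ p ∣ a
  ∤-nonzero≤q a≢0 a≤q p∣a = a≢0 (∣⇒≡0 p∣a (≤-<-trans a≤q q<p))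

  ∤1 : ¬ p ∣ 1
  ∤1 p∣1 = ¬prime[1] (subst Prime (∣1⇒≡1 p∣1) p-prime)

  ∣-square⇒∣ : ∀ {y} → p ∣ y * y → p ∣ y
  ∣-square⇒∣ {y} p∣y² = [ id , id ]′ (euclidsLemma y y p-prime p∣y²)

  ∤⇒coprime : ∀ {z} → ¬ p ∣ z → Coprime p z
  ∤⇒coprime p∤z (d∣p , d∣z) with prime⇒irreducible p-prime d∣p
  ... | inj₁ d≡1    = d≡1
  ... | inj₂ refl   = contradiction d∣z p∤z

  -- With b = a + t, b² − a² = t (2a + t) and both factors are below p.
  square-injective≤ : ∀ {u a b} → ¬ p ∣ u → a ≤ b → b ≤ q → a * a * u ≈ b * b * u → a ≡ b
  square-injective≤ {u} {a} p∤u a≤b b≤q a²u≈b²u with m≤n⇒∃[o]m+o≡n a≤b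
  ... | t , refl = sym (trans (cong (a +_) t≡0) (+-identityʳ a))
    where
    expand : ∀ u a t → (a + t) * (a + t) * u ≡ a * a * u + u * (t * (a + (a + t)))
    expand = solve-∀

    p∣difference : p ∣ u * (t * (a + (a + t)))
    p∣difference = ≈0⇒∣ (+-cancelˡ (begin
      a * a * u + u * (t * (a + (a + t))) ≡⟨ expand u a t ⟨
      (a + t) * (a + t) * u               ≈⟨ a²u≈b²u ⟨
      a * a * u                           ≡⟨ +-identityʳ _ ⟨
      a * a * u + 0                       ∎))
      where open ≈-Reasoning

    a+[a+t]<p : a + (a + t) < p
    a+[a+t]<p = ≤-<-trans (+-monoˡ-≤ (a + t) (m≤m+n a t)) (≤-<-trans (+-mono-≤ b≤q b≤q) q+q<p)

    t≡0 : t ≡ 0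
    t≡0 with euclidsLemma u _ p-prime p∣difference
    ... | inj₁ p∣u = contradiction p∣u p∤u
    ... | inj₂ p∣t[2a+t] with euclidsLemma t _ p-prime p∣t[2a+t]
    ...   | inj₁ p∣t = ∣⇒≡0 p∣t (≤-<-trans (m≤n+m t a) (≤-<-trans b≤q q<p))
    ...   | inj₂ p∣2a+t = m+n≡0⇒n≡0 a (m+n≡0⇒n≡0 a (∣⇒≡0 p∣2a+t a+[a+t]<p))

  square-injective : ∀ {u a b} → ¬ p ∣ u → a ≤ q → b ≤ q → a * a * u ≈ b * b * u → a ≡ b
  square-injective {u} {a} {b} p∤u a≤q b≤q h with ≤-total a b
  ... | inj₁ a≤b = square-injective≤ p∤u a≤b b≤q h
  ... | inj₂ b≤a = sym (square-injective≤ p∤u b≤a a≤q (≈-sym h))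

  diagonal-form-isotropic : ∀ {u v} → ¬ p ∣ u → ¬ p ∣ v → ∀ T →
    ∃₂ λ a b → a ≤ q × b ≤ q × p ∣ a * a * u + (T + b * b * v)
  diagonal-form-isotropic {u} {v} p∤u p∤v T
    with injections-meet {A = A} {B = B} A-inj B-inj p<[1+q]+[1+q]
    where
    A B : Fin (suc q) → Fin p
    A a = (toℕ a * toℕ a * u) mod p
    B b = neg (T + toℕ b * toℕ b * v) mod p

    A-inj : Injective _≡_ _≡_ A
    A-inj {a} {a′} e = Fin.toℕ-injective
      (square-injective p∤u (Fin.toℕ≤pred[n] a) (Fin.toℕ≤pred[n] a′) (mod-≡⇒≈ e))

    B-inj : Injective _≡_ _≡_ B
    B-inj {b} {b′} e = Fin.toℕ-injective (square-injective p∤v (Fin.toℕ≤pred[n] b) (Fin.toℕ≤pred[n] b′)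
      (+-cancelˡ (neg-injective (mod-≡⇒≈ e))))

    p<[1+q]+[1+q] : p < suc q + suc q
    p<[1+q]+[1+q] = s≤s (≤-reflexive (trans p≡1+q+q (sym (+-suc q q))))
  ... | a , b , A≡B = toℕ a , toℕ b , Fin.toℕ≤pred[n] a , Fin.toℕ≤pred[n] b , ≈0⇒∣ (begin
      a² * u + c       ≈⟨ +-congʳ c (mod-≡⇒≈ A≡B) ⟩
      neg c + c        ≈⟨ neg-+ c ⟩
      0                ∎)
    where
    open ≈-Reasoning
    a² = toℕ a * toℕ a
    c  = T + toℕ b * toℕ b * v

  square-representative : ∀ y → ∃ λ a → a ≤ q × a * a ≈ y * y
  square-representative y with y % p ≤? q
  ... | yes y%p≤q = y % p , y%p≤q , *-cong (%-≈ y) (%-≈ y)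
  ... | no  y%p≰q = neg y , neg-y≤q , +≈0⇒square≈ {neg y} (neg-+ y)
    where
    neg-y≤q : neg y ≤ q
    neg-y≤q = ≤-trans (∸-monoʳ-≤ p (≰⇒> y%p≰q))
                      (≤-reflexive (trans (cong (_∸ suc q) p≡1+q+q) (m+n∸n≡m q q)))

  NegatedNonResidue : ℕ → Set
  NegatedNonResidue n = ∀ y → ¬ p ∣ y * y + n

  ∃negatedNonResidue : ∃ λ n → n < p × NegatedNonResidue n
  ∃negatedNonResidue with anyUpTo? (λ n → ¬? (anyUpTo? (λ a → p ∣? a * a + n) (suc q))) p
  ... | yes (n , n<p , no-small-root) = n , n<p , λ y p∣y²+n → no-small-root (small-root y p∣y²+n)
    where
    small-root : ∀ y → p ∣ y * y + n → ∃ λ a → a < suc q × p ∣ a * a + n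
    small-root y p∣y²+n with square-representative y
    ... | a , a≤q , a²≈y² = a , s≤s a≤q , ≈0⇒∣ (≈-trans (+-congʳ n a²≈y²) (∣⇒≈0 p∣y²+n))
  ... | no every-n-rooted = contradiction (Fin.injective⇒≤ root-injective) (<⇒≱ 1+q<p)
    where
    rooted : (n : Fin p) → ∃ λ a → a < suc q × p ∣ a * a + toℕ n
    rooted n = decidable-stable (anyUpTo? (λ a → p ∣? a * a + toℕ n) (suc q))
                 (λ unrooted → every-n-rooted (toℕ n , Fin.toℕ<n n , unrooted))

    root : Fin p → Fin (suc q)
    root n = fromℕ< (proj₁ (proj₂ (rooted n)))

    -- the root a determines n as the residue of −a²
    root-injective : Injective _≡_ _≡_ root
    root-injective {n} {n′} e with rooted n | rooted n′ | e
    ... | a , a<1+q , p∣a²+n | a′ , a′<1+q , p∣a′²+n′ | fromℕ<a≡fromℕ<a′ =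
      Fin.toℕ-injective (≈⇒≡ (Fin.toℕ<n n) (Fin.toℕ<n n′) (+-cancelˡ (begin
        a * a + toℕ n      ≈⟨ ∣⇒≈0 p∣a²+n ⟩
        0                  ≈⟨ ∣⇒≈0 p∣a′²+n′ ⟨
        a′ * a′ + toℕ n′   ≡⟨ cong (λ r → r * r + toℕ n′) a≡a′ ⟨
        a * a + toℕ n′     ∎)))
      where
      open ≈-Reasoning
      a≡a′ : a ≡ a′
      a≡a′ = trans (sym (Fin.toℕ-fromℕ< a<1+q))
                   (trans (cong toℕ fromℕ<a≡fromℕ<a′) (Fin.toℕ-fromℕ< a′<1+q))

  -- Bézout gives z y ≡ ±1, and either sign squares to 1.
  square-inverse : ∀ {z} → ¬ p ∣ z → ∃ λ w → z * w * (z * w) ≈ 1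
  square-inverse {z} p∤z with coprime-Bézout (∤⇒coprime p∤z)
  ... | Bézout.+- x y 1+yz≡xp = y , +≈0⇒square≈ {z * y} {1} (begin
      z * y + 1   ≡⟨ trans (+-comm (z * y) 1) (cong (1 +_) (*-comm z y)) ⟩
      1 + y * z   ≡⟨ 1+yz≡xp ⟩
      x * p       ≈⟨ ∣⇒≈0 (n∣m*n x) ⟩
      0           ∎)
    where open ≈-Reasoning
  ... | Bézout.-+ x y 1+xp≡yz = y , *-cong zy≈1 zy≈1
    where
    zy≈1 : z * y ≈ 1
    zy≈1 = begin
      z * y       ≡⟨ trans (*-comm z y) (sym 1+xp≡yz) ⟩
      1 + x * p   ≈⟨ +-congˡ 1 (∣⇒≈0 (n∣m*n x)) ⟩
      1 + 0       ∎
      where open ≈-Reasoning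

  negatedNonResidue⇒∤ : ∀ {n y z} → NegatedNonResidue n → ¬ p ∣ z → ¬ p ∣ y * y + n * (z * z)
  negatedNonResidue⇒∤ {n} {y} {z} nonResidue p∤z p∣y²+nz² with square-inverse p∤z
  ... | w , [zw]²≈1 = nonResidue (y * w) (≈0⇒∣ (begin
      y * w * (y * w) + n                       ≡⟨ cong (y * w * (y * w) +_) (*-identityʳ n) ⟨
      y * w * (y * w) + n * 1                   ≈⟨ +-congˡ (y * w * (y * w)) (*-congˡ n [zw]²≈1) ⟨
      y * w * (y * w) + n * (z * w * (z * w))   ≡⟨ factor y z w n ⟩
      w * w * (y * y + n * (z * z))             ≈⟨ *-congˡ (w * w) (∣⇒≈0 p∣y²+nz²) ⟩
      w * w * 0                                 ≡⟨ *-zeroʳ (w * w) ⟩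
      0                                         ∎))
    where
    open ≈-Reasoning
    factor : ∀ y z w n → y * w * (y * w) + n * (z * w * (z * w)) ≡ w * w * (y * y + n * (z * z))
    factor = solve-∀

  p∣p^[2t+1] : ∀ t → p ∣ p ^ (2 * t + 1)
  p∣p^[2t+1] t = subst (p ∣_) (cong (p ^_) (+-comm 1 (2 * t))) (m∣m*n (p ^ (2 * t)))

  p^[2[1+t]+1] : ∀ t → p ^ (2 * suc t + 1) ≡ p * p * p ^ (2 * t + 1)
  p^[2[1+t]+1] t = begin
    p ^ (2 * suc t + 1)       ≡⟨ cong (p ^_) (shift t) ⟩
    p * (p * p ^ (2 * t + 1)) ≡⟨ *-assoc p p _ ⟨
    p * p * p ^ (2 * t + 1)   ∎
    where
    open ≡-Reasoning
    shift : ∀ t → 2 * suc t + 1 ≡ 2 + (2 * t + 1)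
    shift = solve-∀

  ∣y²+nz²⇒∣y : ∀ {n y z} → p ∣ z → p ∣ y * y + n * (z * z) → p ∣ y
  ∣y²+nz²⇒∣y {n} {y} {z} p∣z p∣y²+nz² = ∣-square⇒∣
    (∣m+n∣m⇒∣n (subst (p ∣_) (+-comm (y * y) _) p∣y²+nz²) (∣n⇒∣m*n n (∣m⇒∣m*n z p∣z)))

  p^[2t+3]∣[py]²+n[pz]²⇒p^[2t+1]∣y²+nz² : ∀ n t y z →
    p ^ (2 * suc t + 1) ∣ y * p * (y * p) + n * (z * p * (z * p)) → p ^ (2 * t + 1) ∣ y * y + n * (z * z)
  p^[2t+3]∣[py]²+n[pz]²⇒p^[2t+1]∣y²+nz² n t y z h =
    *-cancelˡ-∣ (p * p) (subst₂ _∣_ (p^[2[1+t]+1] t) (factor p n y z) h)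
    where
    factor : ∀ p n y z → y * p * (y * p) + n * (z * p * (z * p)) ≡ p * p * (y * y + n * (z * z))
    factor = solve-∀

  p^[2t+1]∣z²⇒p^[2t+3]∣[pz]² : ∀ t z → p ^ (2 * t + 1) ∣ z * z → p ^ (2 * suc t + 1) ∣ z * p * (z * p)
  p^[2t+1]∣z²⇒p^[2t+3]∣[pz]² t z h =
    subst₂ _∣_ (sym (p^[2[1+t]+1] t)) (factor p z) (*-monoʳ-∣ (p * p) h)
    where
    factor : ∀ p z → p * p * (z * z) ≡ z * p * (z * p)
    factor = solve-∀

  -- Infinite descent: p ∣ z forces p ∣ y, and dividing both by p lowers the exponent by 2.
  descent : ∀ {n} → NegatedNonResidue n → ∀ t y z →
    p ^ (2 * t + 1) ∣ y * y + n * (z * z) → p ^ (2 * t + 1) ∣ z * z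
  descent nonResidue t y z h with p ∣? z
  ... | no p∤z = contradiction (∣-trans (p∣p^[2t+1] t) h) (negatedNonResidue⇒∤ {y = y} nonResidue p∤z)
  descent nonResidue zero y z h | yes p∣z = ∣m⇒∣m*n z (subst (_∣ z) (sym (*-identityʳ p)) p∣z)
  descent {n} nonResidue (suc t) y .(z * p) h | yes p∣z@(divides-refl z)
    with divides-refl y ← ∣y²+nz²⇒∣y {n} {y} p∣z (∣-trans (p∣p^[2t+1] (suc t)) h)
    = p^[2t+1]∣z²⇒p^[2t+3]∣[pz]² t z
        (descent nonResidue t y z (p^[2t+3]∣[py]²+n[pz]²⇒p^[2t+1]∣y²+nz² n t y z h))

module PrimePower (p q : ℕ) (p-prime : Prime p) (p≡2q+1 : p ≡ 2 * q + 1) (s : ℕ) where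

  open OddPrime p q p-prime p≡2q+1

  m W : ℕ
  m = p ^ (2 * s + 1)
  W = p ^ s * p ^ s

  instance
    m-nonZero : NonZero m
    m-nonZero = m^n≢0 p (2 * s + 1)
    W-nonZero : NonZero W
    W-nonZero = m*n≢0 (p ^ s) (p ^ s) {{m^n≢0 p s}} {{m^n≢0 p s}}

  open Congruence m

  m≡W*p : m ≡ W * p
  m≡W*p = begin
    p ^ (2 * s + 1)         ≡⟨ cong (p ^_) (shape s) ⟩
    p ^ (s + s + 1)         ≡⟨ ^-distribˡ-+-* p (s + s) 1 ⟩
    p ^ (s + s) * (p * 1)   ≡⟨ cong₂ _*_ (^-distribˡ-+-* p s s) (*-identityʳ p) ⟩
    W * p                   ∎
    where
    open ≡-Reasoning
    shape : ∀ s → 2 * s + 1 ≡ s + s + 1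
    shape = solve-∀

  W*-∣ : ∀ {Y} → p ∣ Y → m ∣ W * Y
  W*-∣ {Y} p∣Y = subst (_∣ W * Y) (sym m≡W*p) (*-monoʳ-∣ W p∣Y)

  weight : ℕ → ℕ
  weight c = p ^ s * c * (p ^ s * c) % m

  weight≈ : ∀ c → weight c ≈ W * (c * c)
  weight≈ c = ≈-trans (%-≈ _) (≈-reflexive (lemma (p ^ s) c))
    where
    lemma : ∀ P c → P * c * (P * c) ≡ P * P * (c * c)
    lemma = solve-∀

  weight∈S* : ∀ {c} → ¬ p ∣ c → InSStar m (weight c)
  weight∈S* {c} p∤c = m%n<n _ m , m∤weight , p ^ s * c % m , m%n<n _ m ,
    ≈⇒≡[] (≈-trans (*-cong (%-≈ _) (%-≈ _)) (≈-sym (%-≈ _)))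
    where
    m∤weight : ¬ m ∣ weight c
    m∤weight m∣weight = p∤c (∣-square⇒∣ (*-cancelˡ-∣ W (subst (_∣ W * (c * c)) m≡W*p
      (≈0⇒∣ (≈-trans (≈-sym (weight≈ c)) (∣⇒≈0 m∣weight))))))

  hasConsecZS-of-squares : ∀ {k x} i len (c : ℕ → ℕ) → (∀ t → ¬ p ∣ c t) → i + len < k →
    p ∣ blockSum (λ t → c t * c t * x t) i len → HasConsecZS m k x
  hasConsecZS-of-squares {x = x} i len c p∤c i+len<k p∣sum =
    i , len , i+len<k , weight ∘ c , (λ t _ _ → weight∈S* (p∤c t)) , ≈0⇒∣ (begin
      blockSum (λ t → weight (c t) * x t) i len       ≈⟨ blockSum-cong weighted i len ⟩
      blockSum (λ t → W * (c t * c t * x t)) i len    ≡⟨ blockSum-*ˡ W (λ t → c t * c t * x t) i len ⟩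
      W * blockSum (λ t → c t * c t * x t) i len      ≈⟨ ∣⇒≈0 (W*-∣ p∣sum) ⟩
      0                                               ∎)
    where
    open ≈-Reasoning
    weighted : ∀ t → weight (c t) * x t ≈ W * (c t * c t * x t)
    weighted t = ≈-trans (*-congʳ (x t) (weight≈ (c t))) (≈-reflexive (*-assoc W _ (x t)))

  coeffs : ℕ → ℕ → ℕ → ℕ
  coeffs a b zero          = a
  coeffs a b (suc zero)    = 1
  coeffs a b (suc (suc _)) = b

  coeffs-∤ : ∀ {a b} → ¬ p ∣ a → ¬ p ∣ b → ∀ t → ¬ p ∣ coeffs a b t
  coeffs-∤ p∤a p∤b zero          = p∤a
  coeffs-∤ p∤a p∤b (suc zero)    = ∤1
  coeffs-∤ p∤a p∤b (suc (suc _)) = p∤b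

  hasConsecZS-of-p∣term : ∀ {k x} i → i < k → p ∣ x i → HasConsecZS m k x
  hasConsecZS-of-p∣term {x = x} i i<k p∣xᵢ =
    hasConsecZS-of-squares i 0 (λ _ → 1) (λ _ → ∤1) (subst (_< _) (sym (+-identityʳ i)) i<k)
      (subst (p ∣_) (sym (+-identityʳ (x i))) p∣xᵢ)

  -- Terms with coefficient 0 are dropped; since the middle coefficient is 1, the rest stay consecutive.
  hasConsecZS-of-isotropic : ∀ {x} a b → a ≤ q → b ≤ q →
    p ∣ a * a * x 0 + (x 1 + b * b * x 2) → HasConsecZS m 3 x
  hasConsecZS-of-isotropic {x} zero zero _ _ p∣sum =
    hasConsecZS-of-p∣term 1 (s≤s (s≤s z≤n)) (subst (p ∣_) (+-identityʳ (x 1)) p∣sum)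
  hasConsecZS-of-isotropic {x} zero b@(suc _) _ b≤q p∣sum =
    hasConsecZS-of-squares 1 1 (coeffs 1 b) (coeffs-∤ ∤1 (∤-nonzero≤q (λ ()) b≤q)) ≤-refl
      (subst (p ∣_) (cong (_+ b * b * x 2) (sym (+-identityʳ (x 1)))) p∣sum)
  hasConsecZS-of-isotropic {x} a@(suc _) zero a≤q _ p∣sum =
    hasConsecZS-of-squares 0 1 (coeffs a 1) (coeffs-∤ (∤-nonzero≤q (λ ()) a≤q) ∤1) (s≤s (s≤s z≤n)) p∣sum
  hasConsecZS-of-isotropic {x} a@(suc _) b@(suc _) a≤q b≤q p∣sum =
    hasConsecZS-of-squares 0 2 (coeffs a b)
      (coeffs-∤ (∤-nonzero≤q (λ ()) a≤q) (∤-nonzero≤q (λ ()) b≤q)) ≤-refl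
      (subst (p ∣_) (cong (λ r → a * a * x 0 + (r + b * b * x 2)) (sym (+-identityʳ (x 1)))) p∣sum)

  allSeqsHave3 : AllSeqsHave m 3
  allSeqsHave3 x _ with p ∣? x 0 | p ∣? x 2
  ... | yes p∣x₀ | _        = hasConsecZS-of-p∣term 0 (s≤s z≤n) p∣x₀
  ... | no _     | yes p∣x₂ = hasConsecZS-of-p∣term 2 ≤-refl p∣x₂
  ... | no p∤x₀  | no p∤x₂  =
    let a , b , a≤q , b≤q , p∣sum = diagonal-form-isotropic p∤x₀ p∤x₂ (x 1)
    in hasConsecZS-of-isotropic a b a≤q b≤q p∣sum

  S*-∤ : ∀ {w} → InSStar m w → ¬ m ∣ w
  S*-∤ (_ , m∤w , _) = m∤w

  S*-square : ∀ {w} → InSStar m w → ∃ λ z → w ≈ z * z × ¬ m ∣ z * z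
  S*-square (_ , m∤w , z , _ , z²≡w) =
    z , ≈-sym (≡[]⇒≈ z²≡w) , λ m∣z² → m∤w (≈0⇒∣ (≈-trans (≈-sym (≡[]⇒≈ z²≡w)) (∣⇒≈0 m∣z²)))

  module _ {n : ℕ} (nonResidue : NegatedNonResidue n) where

    m∤square+n·square : ∀ y z → ¬ m ∣ z * z → ¬ m ∣ y * y + n * (z * z)
    m∤square+n·square y z m∤z² m∣ = m∤z² (descent nonResidue s y z m∣)

    m∤w₀+w₁n : ∀ {w₀ w₁} → InSStar m w₀ → InSStar m w₁ → ¬ m ∣ w₀ * 1 + w₁ * n
    m∤w₀+w₁n {w₀} {w₁} w₀∈S* w₁∈S* m∣ with S*-square w₀∈S* | S*-square w₁∈S*
    ... | y , w₀≈y² , _ | z , w₁≈z² , m∤z² = m∤square+n·square y z m∤z² (≈0⇒∣ (begin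
        y * y + n * (z * z)   ≈⟨ +-cong (≈-trans (≈-sym w₀≈y²) (≈-reflexive (sym (*-identityʳ w₀))))
                                        (≈-trans (*-congˡ n (≈-sym w₁≈z²)) (≈-reflexive (*-comm n w₁))) ⟩
        w₀ * 1 + w₁ * n       ≈⟨ ∣⇒≈0 m∣ ⟩
        0                     ∎))
      where open ≈-Reasoning

    m∤w*n : ∀ {w} → InSStar m w → ¬ m ∣ w * n
    m∤w*n {w} w∈S* m∣ with S*-square w∈S*
    ... | z , w≈z² , m∤z² = m∤square+n·square 0 z m∤z²
      (≈0⇒∣ (≈-trans (≈-trans (*-congˡ n (≈-sym w≈z²)) (≈-reflexive (*-comm n w))) (∣⇒≈0 m∣)))

    one-then-n : ℕ → ℕ
    one-then-n zero    = 1
    one-then-n (suc _) = n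

    ¬allSeqsHave2 : n < p → ¬ AllSeqsHave m 2
    ¬allSeqsHave2 n<p all with all one-then-n (λ t _ → one-then-n<m t)
      where
      p≤m : p ≤ m
      p≤m = subst (p ≤_) (sym m≡W*p) (m≤n*m p W)
      one-then-n<m : ∀ t → one-then-n t < m
      one-then-n<m zero    = ≤-trans (nonTrivial⇒n>1 p {{prime⇒nonTrivial p-prime}}) p≤m
      one-then-n<m (suc _) = <-≤-trans n<p p≤m
    ... | 0 , 0 , _ , w , w∈S* , m∣ = S*-∤ (w∈S* 0 z≤n z≤n) (subst (m ∣_) (*-identityʳ (w 0)) m∣)
    ... | 0 , 1 , _ , w , w∈S* , m∣ = m∤w₀+w₁n (w∈S* 0 z≤n z≤n) (w∈S* 1 z≤n ≤-refl) m∣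
    ... | 1 , 0 , _ , w , w∈S* , m∣ = m∤w*n (w∈S* 1 ≤-refl ≤-refl) m∣
    ... | 0 , suc (suc _) , s≤s (s≤s ()) , _
    ... | 1 , suc _ , s≤s (s≤s ()) , _
    ... | suc (suc _) , _ , s≤s (s≤s ()) , _

  isCSStar-3 : IsCSStar m 3
  isCSStar-3 = s≤s z≤n , allSeqsHave3 , minimal
    where
    minimal : ∀ k → 1 ≤ k → AllSeqsHave m k → 3 ≤ k
    minimal k _ all with 3 ≤? k
    ... | yes 3≤k = 3≤k
    ... | no 3≰k with ∃negatedNonResidue
    ...   | n , n<p , nonResidue =
      ⊥-elim (¬allSeqsHave2 nonResidue n<p (allSeqsHave-mono (s≤s⁻¹ (≰⇒> 3≰k)) all))

theorem7 : (p r : ℕ) → Prime p → (Σ ℕ λ q → p ≡ 2 * q + 1) → (Σ ℕ λ s → r ≡ 2 * s + 1) →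
    Σ ℕ λ c → IsCSStar (p ^ r) c × c ≤ 3
theorem7 p r p-prime (q , p≡2q+1) (s , refl) = 3 , PrimePower.isCSStar-3 p q p-prime p≡2q+1 s , ≤-refl
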